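{- Let $T$ be a tree of order $n\ge 3$. Then $\iota(\mathrm{Mid}(T))\le \lfloor \frac{n-1}{2}\rfloor$. Moreover, this bound is sharp: for every $n\ge 3$ there exists a tree $T$ of order $n$ with $\iota(\mathrm{Mid}(T))= \lfloor \frac{n-1}{2}\rfloor$.
   Context: For a graph $H$ and $S\subseteq V(H)$, let $N_H[S]$ be $S$ together with all vertices adjacent to a vertex of $S$. A set $S\subseteq V(H)$ is an isolating set of $H$ if $V(H)\setminus N_H[S]$ is an independent set of $H$; $\iota(H)$ is the minimum size of an isolating set of $H$. The middle graph $\mathrm{Mid}(G)$ has vertex set $V(G)\cup\{m_e: e\in E(G)\}$, with $v\sim m_e$ iff $v$ is an endpoint of $e$, $m_e\sim m_f$ iff distinct edges $e,f$ share an endpoint, and no edges between vertices of $V(G)$. -}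

module Defs where

open import Data.Nat using (ℕ; zero; suc; _≤_; _∸_; _+_)
open import Data.Fin using (Fin; zero; suc; inject₁; fromℕ)
open import Data.Product using (Σ; ∃; _×_; _,_; proj₁; proj₂)
open import Data.Sum using (_⊎_; inj₁; inj₂)
open import Data.Empty using (⊥)
open import Data.List using (List; length)
open import Data.List.Membership.Propositional using (_∈_)
open import Data.List.Relation.Unary.Unique.Propositional using (Unique)
open import Relation.Nullary using (¬_)
open import Relation.Binary.PropositionalEquality using (_≡_; _≢_)
open import Function.Definitions using (Injective)

-- Isolating sets in an arbitrary graph, given by a vertex type V and an
-- adjacency relation _~_.  Vertex subsets are duplicate-free lists, so
-- |S| = length S.

module _ {V : Set} (_~_ : V → V → Set) where

  InClosedNbhd : List V → V → Set
  InClosedNbhd S x = x ∈ S ⊎ (∃ λ y → y ∈ S × y ~ x)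

  IsIsolating : List V → Set
  IsIsolating S = ∀ x y → ¬ InClosedNbhd S x → ¬ InClosedNbhd S y → ¬ (x ~ y)

  IotaLe : ℕ → Set
  IotaLe k = ∃ λ (S : List V) → Unique S × IsIsolating S × length S ≤ k

  HasIota : ℕ → Set
  HasIota k =
    (∃ λ (S : List V) → Unique S × IsIsolating S × length S ≡ k)
    × (∀ (S : List V) → Unique S → IsIsolating S → k ≤ length S)

record Graph (n : ℕ) : Set where
  field
    m        : ℕ
    edge     : Fin m → Fin n × Fin n
    loopless : ∀ e → proj₁ (edge e) ≢ proj₂ (edge e)
    -- no two edge indices name the same unordered pair
    simple   : ∀ e f →
               ((proj₁ (edge e) ≡ proj₁ (edge f) × proj₂ (edge e) ≡ proj₂ (edge f))
                ⊎ (proj₁ (edge e) ≡ proj₂ (edge f) × proj₂ (edge e) ≡ proj₁ (edge f)))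
               → e ≡ f

module _ {n : ℕ} (G : Graph n) where
  open Graph G

  Ends : Fin m → Fin n → Set
  Ends e v = v ≡ proj₁ (edge e) ⊎ v ≡ proj₂ (edge e)

  Adj : Fin n → Fin n → Set
  Adj u v = ∃ λ e → (u ≡ proj₁ (edge e) × v ≡ proj₂ (edge e))
                  ⊎ (u ≡ proj₂ (edge e) × v ≡ proj₁ (edge e))

  data Reach : Fin n → Fin n → Set where
    here  : ∀ {u} → Reach u u
    step  : ∀ {u w v} → Adj u w → Reach w v → Reach u v

  Connected : Set
  Connected = ∀ u v → Reach u v

  -- a cycle: k+3 distinct vertices c₀,…,c_{k+2}, consecutive ones adjacent
  -- and c_{k+2} adjacent to c₀
  HasCycle : Set
  HasCycle = ∃ λ (k : ℕ) → ∃ λ (c : Fin (suc (suc (suc k))) → Fin n) →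
               Injective _≡_ _≡_ c
               × (∀ (i : Fin (suc (suc k))) → Adj (c (inject₁ i)) (c (suc i)))
               × Adj (c (fromℕ (suc (suc k)))) (c zero)

  IsTree : Set
  IsTree = Connected × ¬ HasCycle

  -- The middle graph Mid(G): vertices V(G) ⊎ E(G)
  MidAdj : Fin n ⊎ Fin m → Fin n ⊎ Fin m → Set
  MidAdj (inj₁ u) (inj₁ v) = ⊥
  MidAdj (inj₁ v) (inj₂ e) = Ends e v
  MidAdj (inj₂ e) (inj₁ v) = Ends e v
  MidAdj (inj₂ e) (inj₂ f) = e ≢ f × (∃ λ v → Ends e v × Ends f v)

-- Upper bound: the edges of T are the vertices of its line graph L(T), which for n ≥ 3 has
-- no isolated vertex, so by Ore's theorem (the complement of an irredundant dominating set is
-- again dominating) some set of at most half of the m edges dominates L(T). Such a set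
-- isolates Mid(T): every edge-vertex is then covered, and the original vertices are pairwise
-- non-adjacent in Mid(T). Finally m ≤ n − 1, because sending each edge to its endpoint farther
-- from a root is injective in a tree and misses the root.
--
-- Sharpness: in a spider with ⌊(n − 1)/2⌋ legs of length two, the outer edge of each leg and
-- its pendant vertex are adjacent in Mid(T), so an isolating set must meet every leg.

module Submission where

open import Defs
open import Data.Nat as ℕ using (ℕ; zero; suc; _+_; _*_; _∸_; _/_; _≤_; _<_; z≤n; s≤s; parity; ⌊_/2⌋)
open import Data.Nat.Properties
  using (≤-refl; ≤-reflexive; ≤-antisym; ≤-total; ≤-pred; <-≤-trans; ≤-<-trans; <⇒≤; ≰⇒>; ≮⇒≥;
         <-irrefl; <-asym; ≤∧≢⇒<; _≤?_; m<1+n⇒m<n∨m≡n; n≤0⇒n≡0; 0≢1+n; +-comm; +-suc; +-identityʳ;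
         *-comm; +-mono-≤; +-monoʳ-≤; m+[n∸m]≡n; n≡⌊n+n/2⌋; module ≤-Reasoning)
open import Data.Nat.DivMod using (m*n/n≡m; m/n*n≤m; /-monoˡ-≤)
open import Data.Parity using (0ℙ; 1ℙ)
open import Data.Fin using (Fin; zero; suc; toℕ; inject₁; fromℕ; fromℕ<; punchIn; punchOut; _≟_)
open import Data.Fin.Properties
  using (suc-injective; toℕ-injective; toℕ<n; toℕ-inject₁; toℕ-fromℕ<; injective⇒≤; punchIn-injective;
         punchInᵢ≢i; punchIn-punchOut; punchOut-injective; any?; all?; ¬∀⟶∃¬)
open import Data.Fin.Relation.Unary.Top using (view; ‵fromℕ; ‵inject₁)
open import Data.Fin.Subset using (Subset; ⊤; ∁; _-_; ∣_∣; inside; outside) renaming (_∈_ to _∈ₛ_)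
open import Data.Fin.Subset.Properties
  using (∈⊤; ∣p∣≤n; ∣∁p∣≡n∸∣p∣; x∈p⇒∣p-x∣<∣p∣; x∈p∧x≢y⇒x∈p-y; x∉p⇒x∈∁p) renaming (_∈?_ to _∈ₛ?_)
open import Data.Vec using ([]; _∷_; here; there)
open import Data.Product using (Σ; ∃; _×_; _,_; proj₁; proj₂)
open import Data.Sum using (_⊎_; inj₁; inj₂; [_,_]′)
open import Data.Sum.Properties using (inj₂-injective)
open import Data.Empty using (⊥; ⊥-elim)
open import Data.List as List using (List; []; _∷_; length; lookup; allFin)
open import Data.List.Properties using (length-map)
open import Data.List.Extrema.Nat using (argmax; f[xs]≤f[argmax])
open import Data.List.Membership.Propositional using (_∈_; lose)
open import Data.List.Membership.Propositional.Properties using (∈-lookup; ∈-map⁺; ∈-allFin)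
open import Data.List.Relation.Unary.All as All using ([]; _∷_)
import Data.List.Relation.Unary.All.Properties as All
open import Data.List.Relation.Unary.AllPairs using ([]; _∷_)
open import Data.List.Relation.Unary.Any as Any using (Any; here; there; index)
open import Data.List.Relation.Unary.Any.Properties using (lookup-index)
open import Data.List.Relation.Unary.Unique.Propositional using (Unique)
import Data.List.Relation.Unary.Unique.Propositional.Properties as Unique
open import Relation.Nullary using (¬_; Dec; yes; no)
open import Relation.Nullary.Decidable using (_×-dec_; _⊎-dec_; ¬?)
open import Relation.Unary using (Decidable)
open import Relation.Binary.PropositionalEquality
  using (_≡_; _≢_; refl; sym; trans; cong; subst; module ≡-Reasoning)
open import Function using (_∘_)
open import Function.Definitions using (Injective)

n+n≤m⇒n≤m/2 : ∀ n m → n + n ≤ m → n ≤ m / 2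
n+n≤m⇒n≤m/2 n m n+n≤m = subst (_≤ m / 2) (m*n/n≡m n 2) (/-monoˡ-≤ 2 (subst (_≤ m) n+n≡n*2 n+n≤m))
  where
    n+n≡n*2 : n + n ≡ n * 2
    n+n≡n*2 = trans (cong (n +_) (sym (+-identityʳ n))) (*-comm 2 n)

a+b≡m⇒a≤m/2⊎b≤m/2 : ∀ a b m → a + b ≡ m → a ≤ m / 2 ⊎ b ≤ m / 2
a+b≡m⇒a≤m/2⊎b≤m/2 a b m a+b≡m with ≤-total a b
... | inj₁ a≤b = inj₁ (n+n≤m⇒n≤m/2 a m (subst (a + a ≤_) a+b≡m (+-monoʳ-≤ a a≤b)))
... | inj₂ b≤a = inj₂ (n+n≤m⇒n≤m/2 b m (subst (b + b ≤_) (trans (+-comm b a) a+b≡m) (+-monoʳ-≤ b b≤a)))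

m/2+m/2≤m : ∀ m → m / 2 + m / 2 ≤ m
m/2+m/2≤m m = subst (_≤ m) (trans (*-comm (m / 2) 2) (cong (m / 2 +_) (+-identityʳ (m / 2)))) (m/n*n≤m m 2)

⌊1+n/2⌋≡⌊n/2⌋ : ∀ n → parity (suc n) ≡ 1ℙ → ⌊ suc n /2⌋ ≡ ⌊ n /2⌋
⌊1+n/2⌋≡⌊n/2⌋ zero          _   = refl
⌊1+n/2⌋≡⌊n/2⌋ (suc (suc n)) odd = cong suc (⌊1+n/2⌋≡⌊n/2⌋ n odd)

parity[1+n+n]≡1ℙ : ∀ n → parity (suc (n + n)) ≡ 1ℙ
parity[1+n+n]≡1ℙ zero    = refl
parity[1+n+n]≡1ℙ (suc n) rewrite +-suc n n = parity[1+n+n]≡1ℙ n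

⌊1+n+n/2⌋≡n : ∀ n → ⌊ suc (n + n) /2⌋ ≡ n
⌊1+n+n/2⌋≡n n = trans (⌊1+n/2⌋≡⌊n/2⌋ (n + n) (parity[1+n+n]≡1ℙ n)) (sym (n≡⌊n+n/2⌋ n))

least : ∀ {P : ℕ → Set} → Decidable P → ∀ {N} → P N → ∃ λ k → P k × (∀ j → j < k → ¬ P j)
least {P} P? {N} PN with search (suc N)
  where
    search : ∀ b → (∃ λ k → P k × (∀ j → j < k → ¬ P j)) ⊎ (∀ j → j < b → ¬ P j)
    search zero = inj₂ λ _ ()
    search (suc b) with search b
    ... | inj₁ found = inj₁ found
    ... | inj₂ none with P? b
    ...   | yes Pb = inj₁ (b , Pb , none)
    ...   | no ¬Pb = inj₂ λ j j<1+b → [ none j , (λ { refl → ¬Pb }) ]′ (m<1+n⇒m<n∨m≡n j<1+b)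
... | inj₁ found = found
... | inj₂ none  = ⊥-elim (none N ≤-refl PN)

maximum-at : ∀ {k} (f : Fin (suc k) → ℕ) → ∃ λ i → ∀ j → f j ≤ f i
maximum-at f =
  argmax f zero (allFin _) , λ j → All.lookup (f[xs]≤f[argmax] {f = f} zero (allFin _)) (∈-allFin j)

third-vertex : ∀ {k} (a b : Fin (suc (suc (suc k)))) → ∃ λ w → w ≢ a × w ≢ b
third-vertex a b with a ≟ b
... | yes refl = punchIn a zero , punchInᵢ≢i a zero , punchInᵢ≢i a zero
... | no  a≢b  = punchIn a j , punchInᵢ≢i a j , λ eq →
                   punchInᵢ≢i b′ zero (punchIn-injective a j b′ (trans eq (sym (punchIn-punchOut a≢b))))
  where
    b′ = punchOut a≢b
    j  = punchIn b′ zero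

inject₁²≢suc² : ∀ {k} (j : Fin k) → inject₁ (inject₁ j) ≢ suc (suc j)
inject₁²≢suc² zero    ()
inject₁²≢suc² (suc j) eq = inject₁²≢suc² j (suc-injective eq)

lookup-injective : ∀ {A : Set} {xs : List A} → Unique xs → ∀ i j → lookup xs i ≡ lookup xs j → i ≡ j
lookup-injective (_ ∷ _)      zero    zero    _  = refl
lookup-injective (x∉xs ∷ _)   zero    (suc j) eq = ⊥-elim (All.lookup x∉xs (∈-lookup j) eq)
lookup-injective (x∉xs ∷ _)   (suc i) zero    eq = ⊥-elim (All.lookup x∉xs (∈-lookup i) (sym eq))
lookup-injective (_ ∷ unique) (suc i) (suc j) eq = cong suc (lookup-injective unique i j eq)

fibres-met⇒≤-length : ∀ {A : Set} (f : A → ℕ) (S : List A) k →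
                      (∀ i → i < k → Any (λ z → f z ≡ i) S) → k ≤ length S
fibres-met⇒≤-length f S k meets = injective⇒≤ position-injective
  where
    position : Fin k → Fin (length S)
    position i = index (meets (toℕ i) (toℕ<n i))

    position-injective : Injective _≡_ _≡_ position
    position-injective {i} {j} eq = toℕ-injective (begin
      toℕ i                     ≡⟨ sym (lookup-index (meets (toℕ i) _)) ⟩
      f (lookup S (position i)) ≡⟨ cong (λ p → f (lookup S p)) eq ⟩
      f (lookup S (position j)) ≡⟨ lookup-index (meets (toℕ j) _) ⟩
      toℕ j                     ∎)
      where open ≡-Reasoning

elements : ∀ {m} → Subset m → List (Fin m)
elements []            = []
elements (inside  ∷ p) = zero ∷ List.map suc (elements p)
elements (outside ∷ p) = List.map suc (elements p)

∈-elements : ∀ {m x} {p : Subset m} → x ∈ₛ p → x ∈ elements p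
∈-elements {p = inside  ∷ p} here        = here refl
∈-elements {p = inside  ∷ p} (there x∈p) = there (∈-map⁺ suc (∈-elements x∈p))
∈-elements {p = outside ∷ p} (there x∈p) = ∈-map⁺ suc (∈-elements x∈p)

elements-unique : ∀ {m} (p : Subset m) → Unique (elements p)
elements-unique []            = []
elements-unique (inside  ∷ p) =
  All.map⁺ (All.universal (λ _ ()) (elements p)) ∷ Unique.map⁺ suc-injective (elements-unique p)
elements-unique (outside ∷ p) = Unique.map⁺ suc-injective (elements-unique p)

length-elements : ∀ {m} (p : Subset m) → length (elements p) ≡ ∣ p ∣
length-elements []            = refl
length-elements (inside  ∷ p) = cong suc (trans (length-map suc (elements p)) (length-elements p))
length-elements (outside ∷ p) = trans (length-map suc (elements p)) (length-elements p)

module _ {V : Set} {_~_ : V → V → Set} where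

  isolating-meets : ∀ {P : V → Set} → Decidable P → ∀ {S} → IsIsolating _~_ S →
                    ∀ {x y} → x ~ y →
                    (∀ {z} → z ≡ x ⊎ z ~ x → P z) → (∀ {z} → z ≡ y ⊎ z ~ y → P z) →
                    Any P S
  isolating-meets {P} P? {S} isolating {x} {y} x~y Px Py with Any.any? P? S
  ... | yes hit = hit
  ... | no miss = ⊥-elim (isolating x y (off Px) (off Py) x~y)
    where
      off : ∀ {w} → (∀ {z} → z ≡ w ⊎ z ~ w → P z) → ¬ InClosedNbhd _~_ S w
      off Pw (inj₁ w∈S)             = miss (lose w∈S (Pw (inj₁ refl)))
      off Pw (inj₂ (z , z∈S , z~w)) = miss (lose z∈S (Pw (inj₂ z~w)))

  iota-exact : ∀ {k} → IotaLe _~_ k → (∀ S → Unique S → IsIsolating _~_ S → k ≤ length S) → HasIota _~_ k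
  iota-exact (S , unique , isolating , ∣S∣≤k) lower-bound =
    (S , unique , isolating , ≤-antisym ∣S∣≤k (lower-bound S unique isolating)) , lower-bound

-- Ore's theorem on dominating sets

module _ {m : ℕ} (A : Fin m → Fin m → Set) where

  DominatedBy : Subset m → Fin m → Set
  DominatedBy D x = x ∈ₛ D ⊎ ∃ λ y → y ∈ₛ D × A y x

  Dominating : Subset m → Set
  Dominating D = ∀ x → DominatedBy D x

module Ore {m : ℕ} (A : Fin m → Fin m → Set) (A? : ∀ x y → Dec (A x y))
           (A-sym : ∀ {x y} → A x y → A y x) (A-irrefl : ∀ {x} → ¬ A x x)
           (no-isolated : ∀ x → ∃ λ y → A y x) where

  dominatedBy? : ∀ D x → Dec (DominatedBy A D x)
  dominatedBy? D x = (x ∈ₛ? D) ⊎-dec any? (λ y → (y ∈ₛ? D) ×-dec A? y x)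

  Irredundant : Subset m → Set
  Irredundant D = ∀ j → j ∈ₛ D → ¬ Dominating A (D - j)

  irredundant-dominating : ∀ b D → ∣ D ∣ < b → Dominating A D →
                           ∃ λ D′ → Dominating A D′ × Irredundant D′
  irredundant-dominating zero    _ ()       _
  irredundant-dominating (suc b) D ∣D∣<1+b dom
    with any? (λ j → (j ∈ₛ? D) ×-dec all? (dominatedBy? (D - j)))
  ... | yes (j , j∈D , dom′) =
        irredundant-dominating b (D - j) (<-≤-trans (x∈p⇒∣p-x∣<∣p∣ j∈D) (≤-pred ∣D∣<1+b)) dom′
  ... | no none-redundant = D , dom , λ j j∈D dom′ → none-redundant (j , j∈D , dom′)

  -- As D - j fails to dominate some x, either x = j, whose neighbours then all lie
  -- outside D, or x lies outside D and its only neighbour in D is j.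
  ∁-dominating : ∀ D → Dominating A D → Irredundant D → Dominating A (∁ D)
  ∁-dominating D dom irredundant j with j ∈ₛ? D
  ... | no j∉D = inj₁ (x∉p⇒x∈∁p j∉D)
  ... | yes j∈D with ¬∀⟶∃¬ m _ (dominatedBy? (D - j)) (irredundant j j∈D)
  ...   | x , undominated with x ≟ j
  ...     | yes refl = inj₂ (outer-neighbour (no-isolated j))
    where
      outer-neighbour : (∃ λ y → A y j) → ∃ λ y → y ∈ₛ ∁ D × A y j
      outer-neighbour (y , Ayj) with y ∈ₛ? D
      ... | yes y∈D =
            ⊥-elim (undominated (inj₂ (y , x∈p∧x≢y⇒x∈p-y y∈D (λ { refl → A-irrefl Ayj }) , Ayj)))
      ... | no y∉D  = y , x∉p⇒x∈∁p y∉D , Ayj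
  ...     | no x≢j = inj₂ (x , x∉p⇒x∈∁p x∉D , A-sym (j-dominates-x (dom x)))
    where
      x∉D : ¬ x ∈ₛ D
      x∉D x∈D = undominated (inj₁ (x∈p∧x≢y⇒x∈p-y x∈D x≢j))

      j-dominates-x : DominatedBy A D x → A j x
      j-dominates-x (inj₁ x∈D) = ⊥-elim (x∉D x∈D)
      j-dominates-x (inj₂ (y , y∈D , Ayx)) with y ≟ j
      ... | yes refl = Ayx
      ... | no y≢j   = ⊥-elim (undominated (inj₂ (y , x∈p∧x≢y⇒x∈p-y y∈D y≢j , Ayx)))

  dominating-≤-half : ∃ λ D → Dominating A D × ∣ D ∣ ≤ m / 2
  dominating-≤-half with irredundant-dominating (suc m) ⊤ (s≤s (∣p∣≤n ⊤)) (λ _ → inj₁ ∈⊤)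
  ... | D , dom , irredundant with a+b≡m⇒a≤m/2⊎b≤m/2 ∣ D ∣ ∣ ∁ D ∣ m ∣D∣+∣∁D∣≡m
    where
      ∣D∣+∣∁D∣≡m : ∣ D ∣ + ∣ ∁ D ∣ ≡ m
      ∣D∣+∣∁D∣≡m = trans (cong (∣ D ∣ +_) (∣∁p∣≡n∸∣p∣ D)) (m+[n∸m]≡n (∣p∣≤n D))
  ... | inj₁ small = D , dom , small
  ... | inj₂ small = ∁ D , ∁-dominating D dom irredundant , small

module _ {n : ℕ} (G : Graph n) where
  open Graph G

  Joins : Fin m → Fin n → Fin n → Set
  Joins e u v = (u ≡ proj₁ (edge e) × v ≡ proj₂ (edge e)) ⊎ (u ≡ proj₂ (edge e) × v ≡ proj₁ (edge e))

  joins? : ∀ e u v → Dec (Joins e u v)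
  joins? e u v = ((u ≟ proj₁ (edge e)) ×-dec (v ≟ proj₂ (edge e)))
           ⊎-dec ((u ≟ proj₂ (edge e)) ×-dec (v ≟ proj₁ (edge e)))

  Joins-sym : ∀ {e u v} → Joins e u v → Joins e v u
  Joins-sym (inj₁ (u≡ , v≡)) = inj₂ (v≡ , u≡)
  Joins-sym (inj₂ (u≡ , v≡)) = inj₁ (v≡ , u≡)

  Joins-irrefl : ∀ {e u} → ¬ Joins e u u
  Joins-irrefl {e} (inj₁ (u≡ , u≡′)) = loopless e (trans (sym u≡) u≡′)
  Joins-irrefl {e} (inj₂ (u≡ , u≡′)) = loopless e (trans (sym u≡′) u≡)

  Joins-unique : ∀ {e f u v} → Joins e u v → Joins f u v → e ≡ f
  Joins-unique {e} {f} (inj₁ (u≡ , v≡)) (inj₁ (u≡′ , v≡′)) =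
    simple e f (inj₁ (trans (sym u≡) u≡′ , trans (sym v≡) v≡′))
  Joins-unique {e} {f} (inj₁ (u≡ , v≡)) (inj₂ (u≡′ , v≡′)) =
    simple e f (inj₂ (trans (sym u≡) u≡′ , trans (sym v≡) v≡′))
  Joins-unique {e} {f} (inj₂ (u≡ , v≡)) (inj₁ (u≡′ , v≡′)) =
    simple e f (inj₂ (trans (sym v≡) v≡′ , trans (sym u≡) u≡′))
  Joins-unique {e} {f} (inj₂ (u≡ , v≡)) (inj₂ (u≡′ , v≡′)) =
    simple e f (inj₁ (trans (sym v≡) v≡′ , trans (sym u≡) u≡′))

  Joins⇒Ends : ∀ {e u v} → Joins e u v → Ends G e u
  Joins⇒Ends (inj₁ (u≡ , _)) = inj₁ u≡
  Joins⇒Ends (inj₂ (u≡ , _)) = inj₂ u≡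

  Joins⇒endpoints : ∀ {e u v w} → Joins e u v → Ends G e w → w ≡ u ⊎ w ≡ v
  Joins⇒endpoints (inj₁ (u≡ , _))  (inj₁ w≡) = inj₁ (trans w≡ (sym u≡))
  Joins⇒endpoints (inj₁ (_  , v≡)) (inj₂ w≡) = inj₂ (trans w≡ (sym v≡))
  Joins⇒endpoints (inj₂ (_  , v≡)) (inj₁ w≡) = inj₂ (trans w≡ (sym v≡))
  Joins⇒endpoints (inj₂ (u≡ , _))  (inj₂ w≡) = inj₁ (trans w≡ (sym u≡))

  ends? : ∀ e v → Dec (Ends G e v)
  ends? e v = (v ≟ proj₁ (edge e)) ⊎-dec (v ≟ proj₂ (edge e))

  Adj-sym : ∀ {u v} → Adj G u v → Adj G v u
  Adj-sym (e , joins) = e , Joins-sym joins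

  adj? : ∀ u v → Dec (Adj G u v)
  adj? u v = any? λ e → joins? e u v

  Reach-trans : ∀ {u v w} → Reach G u v → Reach G v w → Reach G u w
  Reach-trans here         q = q
  Reach-trans (step u~x p) q = step u~x (Reach-trans p q)

  Reach-sym : ∀ {u v} → Reach G u v → Reach G v u
  Reach-sym here         = here
  Reach-sym (step u~x p) = Reach-trans (Reach-sym p) (step (Adj-sym u~x) here)

  data WalkOfLength : ℕ → Fin n → Fin n → Set where
    []  : ∀ {v} → WalkOfLength 0 v v
    _∷_ : ∀ {k u w v} → Adj G u w → WalkOfLength k w v → WalkOfLength (suc k) u v

  walkOfLength? : ∀ k u v → Dec (WalkOfLength k u v)
  walkOfLength? zero u v with u ≟ v
  ... | yes refl = yes []
  ... | no  u≢v  = no λ { [] → u≢v refl }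
  walkOfLength? (suc k) u v with any? (λ w → adj? u w ×-dec walkOfLength? k w v)
  ... | yes (w , u~w , walk) = yes (u~w ∷ walk)
  ... | no  none             = no λ { (_∷_ {w = w} u~w walk) → none (w , u~w , walk) }

  Reach⇒WalkOfLength : ∀ {u v} → Reach G u v → ∃ λ k → WalkOfLength k u v
  Reach⇒WalkOfLength here         = 0 , []
  Reach⇒WalkOfLength (step u~w p) with Reach⇒WalkOfLength p
  ... | k , walk = suc k , u~w ∷ walk

  data WalkAvoiding (e : Fin m) : Fin n → Fin n → Set where
    []   : ∀ {v} → WalkAvoiding e v v
    step : ∀ {u w v} g → g ≢ e → Joins g u w → WalkAvoiding e w v → WalkAvoiding e u v

  walk-++ : ∀ {e u v w} → WalkAvoiding e u v → WalkAvoiding e v w → WalkAvoiding e u w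
  walk-++ []                   q = q
  walk-++ (step g g≢e joins p) q = step g g≢e joins (walk-++ p q)

  walk-reverse : ∀ {e u v} → WalkAvoiding e u v → WalkAvoiding e v u
  walk-reverse []                   = []
  walk-reverse (step g g≢e joins p) = walk-++ (walk-reverse p) (step g g≢e (Joins-sym joins) [])

  data PathAvoiding (e : Fin m) (v : Fin n) : List (Fin n) → Set where
    end  : PathAvoiding e v (v ∷ [])
    step : ∀ {u w ws} g → g ≢ e → Joins g u w → PathAvoiding e v (w ∷ ws) → PathAvoiding e v (u ∷ w ∷ ws)

  path-suffix : ∀ {e v u xs} → PathAvoiding e v xs → Unique xs → u ∈ xs →
                ∃ λ ys → PathAvoiding e v (u ∷ ys) × Unique (u ∷ ys)
  path-suffix {xs = _ ∷ ys} path  unique       (here refl)  = ys , path , unique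
  path-suffix (step _ _ _ path)   (_ ∷ unique) (there u∈xs) = path-suffix path unique u∈xs

  walk⇒path : ∀ {e u v} → WalkAvoiding e u v → ∃ λ ys → PathAvoiding e v (u ∷ ys) × Unique (u ∷ ys)
  walk⇒path []                                        = [] , end , [] ∷ []
  walk⇒path {u = u} (step {w = w} g g≢e joins walk) with walk⇒path walk
  ... | ys , path , unique with Any.any? (u ≟_) (w ∷ ys)
  ...   | yes u∈path = path-suffix path unique u∈path
  ...   | no  u∉path = w ∷ ys , step g g≢e joins path , All.¬Any⇒All¬ _ u∉path ∷ unique

  path-last : ∀ {e v x xs} → PathAvoiding e v (x ∷ xs) → lookup (x ∷ xs) (fromℕ (length xs)) ≡ v
  path-last end               = refl
  path-last (step _ _ _ path) = path-last path

  path-adjacent : ∀ {e v x xs} → PathAvoiding e v (x ∷ xs) → ∀ (i : Fin (length xs)) →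
                  Adj G (lookup (x ∷ xs) (inject₁ i)) (lookup (x ∷ xs) (suc i))
  path-adjacent (step g _ joins _)    zero    = g , joins
  path-adjacent (step _ _ _     path) (suc i) = path-adjacent path i

  -- A walk avoiding e shortens to a path, which e closes into a cycle; the path has at
  -- least three vertices because G has neither loops nor parallel edges.
  avoiding-walk⇒cycle : ∀ {e u v} → Joins e u v → WalkAvoiding e u v → HasCycle G
  avoiding-walk⇒cycle {e} {u} joins walk with walk⇒path walk
  ... | []     , end                    , _ = ⊥-elim (Joins-irrefl joins)
  ... | _ ∷ [] , step g g≢e joins′ end , _ = ⊥-elim (g≢e (Joins-unique joins′ joins))
  ... | y₁ ∷ y₂ ∷ ys , path , unique =
        length ys , lookup (u ∷ y₁ ∷ y₂ ∷ ys) , lookup-injective unique _ _ , path-adjacent path ,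
        subst (λ z → Adj G z u) (sym (path-last path)) (e , Joins-sym joins)

  cycle-neighbours : ∀ {k} (c : Fin (suc (suc (suc k))) → Fin n) →
                     (∀ i → Adj G (c (inject₁ i)) (c (suc i))) → Adj G (c (fromℕ (suc (suc k)))) (c zero) →
                     ∀ i → ∃ λ j₁ → ∃ λ j₂ → j₁ ≢ j₂ × Adj G (c i) (c j₁) × Adj G (c i) (c j₂)
  cycle-neighbours c adj adj-last zero = suc zero , fromℕ _ , (λ ()) , adj zero , Adj-sym adj-last
  cycle-neighbours c adj adj-last (suc i) with view i
  ... | ‵fromℕ     = inject₁ i , zero , (λ ()) , Adj-sym (adj i) , adj-last
  ... | ‵inject₁ j = inject₁ i , suc (suc j) , inject₁²≢suc² j , Adj-sym (adj i) , adj (suc j)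

  -- On a cycle, the vertex maximising h has two distinct neighbours below it.
  unique-lower-neighbour⇒acyclic : (h : Fin n → ℕ) → (∀ {x y} → Adj G x y → h x ≢ h y) →
                                   (∀ {x y z} → Adj G x y → Adj G x z → h y < h x → h z < h x → y ≡ z) →
                                   ¬ HasCycle G
  unique-lower-neighbour⇒acyclic h adj-≢ lower-unique (k , c , c-injective , adj , adj-last) =
    no-maximum (maximum-at (h ∘ c))
    where
      no-maximum : (∃ λ top → ∀ j → h (c j) ≤ h (c top)) → ⊥
      no-maximum (top , maximal) = two-lower (cycle-neighbours c adj adj-last top)
        where
          below : ∀ {j} → Adj G (c top) (c j) → h (c j) < h (c top)
          below {j} top~j = ≤∧≢⇒< (maximal j) (λ eq → adj-≢ top~j (sym eq))

          two-lower : (∃ λ j₁ → ∃ λ j₂ → j₁ ≢ j₂ × Adj G (c top) (c j₁) × Adj G (c top) (c j₂)) → ⊥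
          two-lower (j₁ , j₂ , j₁≢j₂ , adj₁ , adj₂) =
            j₁≢j₂ (c-injective (lower-unique adj₁ adj₂ (below adj₁) (below adj₂)))

-- Trees have at most n − 1 edges

module Distance {n : ℕ} (G : Graph n) (connected : Connected G) (r : Fin n) where
  open Graph G

  private
    shortest : ∀ v → ∃ λ k → WalkOfLength G k v r × (∀ j → j < k → ¬ WalkOfLength G j v r)
    shortest v = least (λ k → walkOfLength? G k v r) (proj₂ (Reach⇒WalkOfLength G (connected v r)))

  dist : Fin n → ℕ
  dist v = proj₁ (shortest v)

  dist-minimal : ∀ {k v} → WalkOfLength G k v r → dist v ≤ k
  dist-minimal {k} {v} walk = ≮⇒≥ λ k<dist → proj₂ (proj₂ (shortest v)) k k<dist walk

  dist≡0⇒≡root : ∀ {v} → dist v ≡ 0 → v ≡ r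
  dist≡0⇒≡root {v} dist≡0 = at-root (subst (λ k → WalkOfLength G k v r) dist≡0 (proj₁ (proj₂ (shortest v))))
    where
      at-root : WalkOfLength G 0 v r → v ≡ r
      at-root [] = refl

  closer-neighbour : ∀ v → v ≢ r → ∃ λ u → Adj G v u × dist u < dist v
  closer-neighbour v v≢r = first-step (proj₁ (proj₂ (shortest v))) refl
    where
      first-step : ∀ {k} → WalkOfLength G k v r → k ≡ dist v → ∃ λ u → Adj G v u × dist u < dist v
      first-step []                     _      = ⊥-elim (v≢r refl)
      first-step (_∷_ {w = u} v~u walk) k≡dist = u , v~u , subst (dist u <_) k≡dist (s≤s (dist-minimal walk))

  -- Walking to ever closer neighbours never visits w, hence never uses an edge at w.
  descend : ∀ {e w} → Ends G e w → ∀ b a → dist a < b → dist a ≤ dist w → a ≢ w → WalkAvoiding G e a r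
  descend {e} {w} e∋w (suc b) a a<b a≤w a≢w with a ≟ r
  ... | yes refl = []
  ... | no  a≢r with closer-neighbour a a≢r
  ...   | u , (g , joins) , u<a =
          step g g≢e joins
            (descend e∋w b u (<-≤-trans u<a (≤-pred a<b)) (<⇒≤ u<w) λ { refl → <-irrefl refl u<w })
    where
      u<w : dist u < dist w
      u<w = <-≤-trans u<a a≤w

      g≢e : g ≢ e
      g≢e refl with Joins⇒endpoints G joins e∋w
      ... | inj₁ refl = a≢w refl
      ... | inj₂ refl = <-irrefl refl u<w

  far-end : ∀ e → ∃ λ w → ∃ λ o → Joins G e w o × dist o ≤ dist w
  far-end e with dist (proj₁ (edge e)) ≤? dist (proj₂ (edge e))
  ... | yes ≤ = proj₂ (edge e) , proj₁ (edge e) , inj₂ (refl , refl) , ≤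
  ... | no  ≰ = proj₁ (edge e) , proj₂ (edge e) , inj₁ (refl , refl) , <⇒≤ (≰⇒> ≰)

  far : Fin m → Fin n
  far e = proj₁ (far-end e)

  root≢far : ∀ e → r ≢ far e
  root≢far e r≡far with far-end e
  ... | w , o , joins , o≤w with refl ← r≡far =
        Joins-irrefl G (subst (Joins G e r) (dist≡0⇒≡root (n≤0⇒n≡0 (subst (dist o ≤_) dist-root o≤w))) joins)
    where
      dist-root : dist r ≡ 0
      dist-root = n≤0⇒n≡0 (dist-minimal [])

  -- Two edges with the same far end w would close a cycle through w and the root.
  far-injective : ¬ HasCycle G → Injective _≡_ _≡_ far
  far-injective acyclic {e} {f} far≡ with e ≟ f
  ... | yes e≡f = e≡f
  ... | no  e≢f with far-end e | far-end f
  ...   | w , o , joins-e , o≤w | _ , o′ , joins-f , o′≤w with refl ← far≡ =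
          ⊥-elim (acyclic (avoiding-walk⇒cycle G joins-e
            (step f (λ f≡e → e≢f (sym f≡e)) joins-f
              (walk-++ G (down o′ o′≤w (λ { refl → Joins-irrefl G joins-f }))
                         (walk-reverse G (down o o≤w (λ { refl → Joins-irrefl G joins-e })))))))
    where
      down : ∀ a → dist a ≤ dist w → a ≢ w → WalkAvoiding G e a r
      down a = descend (Joins⇒Ends G joins-e) (suc (dist a)) a ≤-refl

tree-edges≤ : ∀ {n} (T : Graph (suc n)) → IsTree T → Graph.m T ≤ n
tree-edges≤ T (connected , acyclic) =
  injective⇒≤ {f = λ e → punchOut (root≢far e)}
    λ eq → far-injective acyclic (punchOut-injective (root≢far _) (root≢far _) eq)
  where open Distance T connected zero

-- The upper bound

module _ {n : ℕ} (G : Graph n) where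
  open Graph G

  LineAdj : Fin m → Fin m → Set
  LineAdj f e = MidAdj G (inj₂ f) (inj₂ e)

  lineAdj? : ∀ f e → Dec (LineAdj f e)
  lineAdj? f e = ¬? (f ≟ e) ×-dec any? (λ v → ends? G f v ×-dec ends? G e v)

  LineAdj-sym : ∀ {f e} → LineAdj f e → LineAdj e f
  LineAdj-sym (f≢e , v , f∋v , e∋v) = (λ e≡f → f≢e (sym e≡f)) , v , e∋v , f∋v

  LineAdj-irrefl : ∀ {e} → ¬ LineAdj e e
  LineAdj-irrefl (e≢e , _) = e≢e refl

  -- The first edge other than e used by a walk from an endpoint of e to a vertex off e
  -- meets e.
  leaving-edge : ∀ {e a w} → Ends G e a → ¬ Ends G e w → Reach G a w → ∃ λ f → LineAdj f e
  leaving-edge e∋a e∌w here = ⊥-elim (e∌w e∋a)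
  leaving-edge {e} {a} e∋a e∌w (step (g , joins) walk) with g ≟ e
  ... | yes refl = leaving-edge (Joins⇒Ends G (Joins-sym G joins)) e∌w walk
  ... | no  g≢e  = g , g≢e , a , Joins⇒Ends G joins , e∋a

  line-dominating⇒isolating : ∀ D → Dominating LineAdj D →
                              IsIsolating (MidAdj G) (List.map inj₂ (elements D))
  line-dominating⇒isolating D dominating = isolating
    where
      covered : ∀ e → InClosedNbhd (MidAdj G) (List.map inj₂ (elements D)) (inj₂ e)
      covered e with dominating e
      ... | inj₁ e∈D             = inj₁ (∈-map⁺ inj₂ (∈-elements e∈D))
      ... | inj₂ (f , f∈D , f~e) = inj₂ (inj₂ f , ∈-map⁺ inj₂ (∈-elements f∈D) , f~e)

      isolating : IsIsolating (MidAdj G) (List.map inj₂ (elements D))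
      isolating (inj₁ _) (inj₁ _) _   _   ()
      isolating (inj₁ _) (inj₂ e) _   off _ = off (covered e)
      isolating (inj₂ e) _        off _   _ = off (covered e)

iota-mid-tree≤ : ∀ n → 3 ≤ n → (T : Graph n) → IsTree T → IotaLe (MidAdj T) ((n ∸ 1) / 2)
iota-mid-tree≤ (suc (suc (suc k))) (s≤s (s≤s (s≤s z≤n))) T tree@(connected , _)
  with Ore.dominating-≤-half (LineAdj T) (lineAdj? T) (LineAdj-sym T) (LineAdj-irrefl T) no-isolated
  where
    no-isolated : ∀ e → ∃ λ f → LineAdj T f e
    no-isolated e with third-vertex (proj₁ (Graph.edge T e)) (proj₂ (Graph.edge T e))
    ... | w , w≢₁ , w≢₂ = leaving-edge T (inj₁ refl) [ w≢₁ , w≢₂ ]′ (connected _ w)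
... | D , dominating , ∣D∣≤m/2 =
      List.map inj₂ (elements D) ,
      Unique.map⁺ inj₂-injective (elements-unique D) ,
      line-dominating⇒isolating T D dominating ,
      (begin
        length (List.map inj₂ (elements D)) ≡⟨ length-map inj₂ (elements D) ⟩
        length (elements D)                 ≡⟨ length-elements D ⟩
        ∣ D ∣                               ≤⟨ ∣D∣≤m/2 ⟩
        Graph.m T / 2                       ≤⟨ /-monoˡ-≤ 2 (tree-edges≤ T tree) ⟩
        suc (suc k) / 2                     ∎)
  where open ≤-Reasoning

-- Sharpness

module ParentTree {N : ℕ} (parent : Fin N → Fin (suc N)) (parent≤ : ∀ t → toℕ (parent t) ≤ toℕ t) where

  parent<suc : ∀ t → toℕ (parent t) < toℕ (suc t)
  parent<suc t = s≤s (parent≤ t)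

  tree : Graph (suc N)
  tree = record
    { m        = N
    ; edge     = λ t → parent t , suc t
    ; loopless = λ t eq → <-irrefl (cong toℕ eq) (parent<suc t)
    ; simple   = simple
    }
    where
      simple : ∀ e f → (parent e ≡ parent f × suc e ≡ suc f) ⊎ (parent e ≡ suc f × suc e ≡ parent f) → e ≡ f
      simple e f (inj₁ (_ , suc-e≡suc-f))    = suc-injective suc-e≡suc-f
      simple e f (inj₂ (parent-e≡ , suc-e≡)) = ⊥-elim (<-asym
        (subst (_< toℕ (suc e)) (cong toℕ parent-e≡) (parent<suc e))
        (subst (_< toℕ (suc f)) (cong toℕ (sym suc-e≡)) (parent<suc f)))

  lower-neighbour : ∀ {x y} → Adj tree x y → toℕ y < toℕ x → ∃ λ t → x ≡ suc t × y ≡ parent t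
  lower-neighbour (t , inj₁ (refl , refl)) y<x = ⊥-elim (<-asym y<x (parent<suc t))
  lower-neighbour (t , inj₂ (x≡ , y≡))     _   = t , x≡ , y≡

  lower-neighbour-unique : ∀ {x y z} → Adj tree x y → Adj tree x z →
                           toℕ y < toℕ x → toℕ z < toℕ x → y ≡ z
  lower-neighbour-unique x~y x~z y<x z<x with lower-neighbour x~y y<x | lower-neighbour x~z z<x
  ... | t , refl , refl | s , x≡ , refl with refl ← suc-injective x≡ = refl

  adj-toℕ-≢ : ∀ {x y} → Adj tree x y → toℕ x ≢ toℕ y
  adj-toℕ-≢ (t , inj₁ (refl , refl)) eq = <-irrefl eq (parent<suc t)
  adj-toℕ-≢ (t , inj₂ (refl , refl)) eq = <-irrefl (sym eq) (parent<suc t)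

  reach-root : ∀ b v → toℕ v < b → Reach tree v zero
  reach-root _       zero    _         = here
  reach-root (suc b) (suc t) (s≤s t<b) =
    step (t , inj₂ (refl , refl)) (reach-root b (parent t) (≤-<-trans (parent≤ t) t<b))

  isTree : IsTree tree
  isTree = (λ u v → Reach-trans tree (reach-root _ u ≤-refl) (Reach-sym tree (reach-root _ v ≤-refl)))
         , unique-lower-neighbour⇒acyclic tree toℕ adj-toℕ-≢ lower-neighbour-unique

module Spider (N : ℕ) where

  -- Edge 2i joins the centre 0 to 2i+1 and edge 2i+1 joins 2i+1 to 2i+2, so the tree
  -- consists of ⌊N/2⌋ legs of length two (and one pendant edge if N is odd).
  parent : Fin N → Fin (suc N)
  parent t with parity (toℕ t)
  ... | 0ℙ = zero
  ... | 1ℙ = inject₁ t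

  parent≤ : ∀ t → toℕ (parent t) ≤ toℕ t
  parent≤ t with parity (toℕ t)
  ... | 0ℙ = z≤n
  ... | 1ℙ = ≤-reflexive (toℕ-inject₁ t)

  parent-odd : ∀ t → parity (toℕ t) ≡ 1ℙ → parent t ≡ inject₁ t
  parent-odd t odd rewrite odd = refl

  open ParentTree parent parent≤ public using (tree; isTree)

  -- The centre lies on no leg; its value is irrelevant.
  leg : Fin (suc N) ⊎ Fin N → ℕ
  leg (inj₁ zero)    = 0
  leg (inj₁ (suc t)) = ⌊ toℕ t /2⌋
  leg (inj₂ t)       = ⌊ toℕ t /2⌋

  endpoint-leg : ∀ {s v} → Ends tree s v → v ≢ zero → leg (inj₁ v) ≡ leg (inj₂ s)
  endpoint-leg         (inj₂ refl) _   = refl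
  endpoint-leg {zero}  (inj₁ refl) v≢0 = ⊥-elim (v≢0 refl)
  endpoint-leg {suc s} (inj₁ refl) v≢0 with parity (suc (toℕ s)) in odd
  ... | 0ℙ = ⊥-elim (v≢0 refl)
  ... | 1ℙ = trans (cong ⌊_/2⌋ (toℕ-inject₁ s)) (sym (⌊1+n/2⌋≡⌊n/2⌋ (toℕ s) odd))

  leg-near-vertex : ∀ {v z} → v ≢ zero → z ≡ inj₁ v ⊎ MidAdj tree z (inj₁ v) → leg z ≡ leg (inj₁ v)
  leg-near-vertex              _   (inj₁ refl) = refl
  leg-near-vertex {z = inj₂ s} v≢0 (inj₂ s∋v)  = sym (endpoint-leg s∋v v≢0)

  leg-near-edge : ∀ {e z} → (∀ {v} → Ends tree e v → v ≢ zero) →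
                  z ≡ inj₂ e ⊎ MidAdj tree z (inj₂ e) → leg z ≡ leg (inj₂ e)
  leg-near-edge              _    (inj₁ refl)                = refl
  leg-near-edge {z = inj₁ v} off₀ (inj₂ e∋v)                 = endpoint-leg e∋v (off₀ e∋v)
  leg-near-edge {z = inj₂ s} off₀ (inj₂ (_ , v , s∋v , e∋v)) =
    trans (sym (endpoint-leg s∋v (off₀ e∋v))) (endpoint-leg e∋v (off₀ e∋v))

  -- The outer edge 2i+1 of leg i and its pendant vertex 2i+2 are adjacent in Mid(T), and
  -- everything next to either of them lies on leg i.
  isolating-meets-leg : ∀ {S} → IsIsolating (MidAdj tree) S → ∀ i → i < N / 2 → Any (λ z → leg z ≡ i) S
  isolating-meets-leg isolating i i<N/2 =
    isolating-meets (λ z → leg z ℕ.≟ i) isolating {inj₁ (suc outer)} {inj₂ outer} (inj₂ refl)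
      (λ near → trans (leg-near-vertex (λ ()) near) leg-outer)
      (λ near → trans (leg-near-edge off-centre near) leg-outer)
    where
      outer : Fin N
      outer = fromℕ< {suc (i + i)} (begin-strict
        suc (i + i)   <⟨ s≤s (≤-reflexive (sym (+-suc i i))) ⟩
        suc i + suc i ≤⟨ +-mono-≤ i<N/2 i<N/2 ⟩
        N / 2 + N / 2 ≤⟨ m/2+m/2≤m N ⟩
        N             ∎)
        where open ≤-Reasoning

      toℕ-outer : toℕ outer ≡ suc (i + i)
      toℕ-outer = toℕ-fromℕ< _

      leg-outer : ⌊ toℕ outer /2⌋ ≡ i
      leg-outer = trans (cong ⌊_/2⌋ toℕ-outer) (⌊1+n+n/2⌋≡n i)

      off-centre : ∀ {v} → Ends tree outer v → v ≢ zero
      off-centre (inj₂ refl) ()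
      off-centre (inj₁ refl) parent≡0 = 0≢1+n (begin
        0                    ≡⟨ cong toℕ parent≡0 ⟨
        toℕ (parent outer)   ≡⟨ cong toℕ (parent-odd outer odd) ⟩
        toℕ (inject₁ outer)  ≡⟨ toℕ-inject₁ outer ⟩
        toℕ outer            ≡⟨ toℕ-outer ⟩
        suc (i + i)          ∎)
        where
          open ≡-Reasoning
          odd : parity (toℕ outer) ≡ 1ℙ
          odd = subst (λ t → parity t ≡ 1ℙ) (sym toℕ-outer) (parity[1+n+n]≡1ℙ i)

  isolating-size≥ : ∀ S → Unique S → IsIsolating (MidAdj tree) S → N / 2 ≤ length S
  isolating-size≥ S _ isolating = fibres-met⇒≤-length leg S (N / 2) (isolating-meets-leg isolating)

iota-mid-spider : ∀ n → 3 ≤ n → Σ (Graph n) (λ T → IsTree T × HasIota (MidAdj T) ((n ∸ 1) / 2))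
iota-mid-spider (suc N) 3≤n =
  tree , isTree , iota-exact (iota-mid-tree≤ (suc N) 3≤n tree isTree) isolating-size≥
  where open Spider N

theorem3 : ((n : ℕ) → 3 ≤ n → (T : Graph n) → IsTree T →
              IotaLe (MidAdj T) ((n ∸ 1) / 2))
           × ((n : ℕ) → 3 ≤ n →
              Σ (Graph n) (λ T → IsTree T × HasIota (MidAdj T) ((n ∸ 1) / 2)))
theorem3 = iota-mid-tree≤ , iota-mid-spider
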